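{- Let $m\ge 3$ and let $\mathscr{A}=(A_{n,k})_{n\ge k\ge 0}\in SDR_m$. Then for any fixed integers $i,j\ge 0$, the matrix $(A_{n+i,k+j})_{n\ge k\ge 0}$ belongs to $SDR_m$.
   Context: All matrices are infinite lower triangular matrices $\mathscr{A}=(A_{n,k})_{n\ge k\ge 0}$ with complex entries; we set $A_{n,k}=0$ whenever $k>n$ (so $(A_{n+i,k+j})_{n\ge k\ge 0}$ is the lower triangular matrix whose $(n,k)$ entry for $n\ge k$ is $A_{n+i,k+j}$). For an integer $m\ge 3$, $\mathscr{A}$ is called an SDR-matrix of order $m$ (written $\mathscr{A}\in SDR_m$) if for all integers $n,k\ge 0$, all $2\le p\le m-1$ and all $0\le r\le p-1$, $$\prod_{i=0}^{r}A_{n+i,k+r-i}\prod_{i=0}^{p-r-1}A_{n+p-i,k+r+i+1}=\prod_{i=0}^{r}A_{n+p-i,k+p-r+i}\prod_{i=0}^{p-r-1}A_{n+i,k+p-r-i-1}.$$ -}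

module Defs where

open import Algebra.Bundles using (CommutativeRing)
open import Data.Nat using (ℕ; zero; suc; _+_; _∸_; _≤_; _<_; _≤?_)
open import Data.Product using (_×_)
open import Relation.Nullary using (yes; no)

-- Matrices with entries in a commutative ring R (ℂ in the paper),
-- represented as functions ℕ → ℕ → Carrier, A n k = A_{n,k}.
module _ {c ℓ} (R : CommutativeRing c ℓ) where
  open CommutativeRing R using (Carrier; _≈_; _*_; 1#; 0#)

  Matrix : Set c
  Matrix = ℕ → ℕ → Carrier

  -- prod N f = f 0 * f 1 * ... * f (N-1);  ∏_{i=0}^{r} f i = prod (suc r) f
  prod : ℕ → (ℕ → Carrier) → Carrier
  prod zero    f = 1#
  prod (suc N) f = prod N f * f N

  LowerTriangular : Matrix → Set ℓ
  LowerTriangular A = ∀ n k → n < k → A n k ≈ 0#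

  SDRIdentities : ℕ → Matrix → Set ℓ
  SDRIdentities m A = ∀ n k p r → 2 ≤ p → p ≤ m ∸ 1 → r ≤ p ∸ 1 →
    prod (suc r) (λ i → A (n + i) (k + (r ∸ i)))
      * prod (p ∸ r) (λ i → A (n + (p ∸ i)) (k + (r + i + 1)))
    ≈ prod (suc r) (λ i → A (n + (p ∸ i)) (k + (p ∸ r) + i))
      * prod (p ∸ r) (λ i → A (n + i) (k + ((p ∸ r) ∸ suc i)))

  SDR : ℕ → Matrix → Set ℓ
  SDR m A = LowerTriangular A × SDRIdentities m A

  shift : ℕ → ℕ → Matrix → Matrix
  shift i j A n k with k ≤? n
  ... | yes _ = A (n + i) (k + j)
  ... | no  _ = 0#

-- Write B for the shifted matrix and T for the plain translate T x y = A (x + i) (y + j),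
-- so B agrees with T on and below the diagonal and vanishes above it. T satisfies the
-- SDR identities because they are invariant under translation of (n, k). If k + r ≤ n and
-- k + (p - r - 1) ≤ n, every entry of the identity of B at (n, k, p, r) lies on or below the
-- diagonal, so it is the identity of T there. Otherwise each side of the identity contains
-- an entry above the diagonal, so both sides are 0.
module Submission where

open import Defs
open import Algebra.Bundles using (CommutativeRing)
open import Data.Nat using (ℕ; zero; suc; _+_; _∸_; _≤_; _<_; _≤?_; z<s)
open import Data.Nat.Properties
  using (≤-refl; ≤-trans; m≤m+n; m∸n≤m; +-monoˡ-≤; +-monoʳ-≤; +-monoˡ-<; +-assoc; +-comm;
         +-suc; +-identityʳ; +-∸-comm; m+n∸m≡n; m<n⇒m<1+n; m<1+n⇒m≤n; ≰⇒>; <⇒≱;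
         m≤n⇒m<n∨m≡n; m≤n⇒∃[o]m+o≡n)
open import Data.Nat.Tactic.RingSolver using (solve-∀)
open import Data.Product using (_,_)
open import Data.Sum using (inj₁; inj₂)
open import Relation.Nullary using (yes; no)
open import Relation.Nullary.Negation using (contradiction)
open import Relation.Binary.PropositionalEquality as ≡ using (_≡_; cong; cong₂; subst; subst₂)

k+[x∸a]≤n+a : ∀ {k x n} a → k + x ≤ n → k + (x ∸ a) ≤ n + a
k+[x∸a]≤n+a {k} {x} {n} a k+x≤n =
  ≤-trans (+-monoʳ-≤ k (m∸n≤m x a)) (≤-trans k+x≤n (m≤m+n n a))

k+a+y≤n+[x+y∸a] : ∀ {k x n a} y → a ≤ x → k + x ≤ n → k + a + y ≤ n + (x + y ∸ a)
k+a+y≤n+[x+y∸a] {k} {x} {n} {a} y a≤x k+x≤n = subst (k + a + y ≤_) n+[x∸a]+y≡n+[x+y∸a]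
  (+-monoˡ-≤ y (≤-trans (+-monoʳ-≤ k a≤x) (≤-trans k+x≤n (m≤m+n n (x ∸ a)))))
  where
  n+[x∸a]+y≡n+[x+y∸a] : n + (x ∸ a) + y ≡ n + (x + y ∸ a)
  n+[x∸a]+y≡n+[x+y∸a] = ≡.trans (+-assoc n (x ∸ a) y) (cong (n +_) (≡.sym (+-∸-comm y a≤x)))

n+y<k+y+x : ∀ {n k x} y → n < k + x → n + y < k + y + x
n+y<k+y+x {n} {k} {x} y n<k+x = subst (n + y <_) (+-right-comm k x y) (+-monoˡ-< y n<k+x)
  where
  +-right-comm : ∀ k x y → k + x + y ≡ k + y + x
  +-right-comm = solve-∀

1+m+n∸m≡1+n : ∀ m n → suc (m + n) ∸ m ≡ suc n
1+m+n∸m≡1+n m n = ≡.trans (cong (_∸ m) (≡.sym (+-suc m n))) (m+n∸m≡n m (suc n))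

1+m+n∸n≡1+m : ∀ m n → suc (m + n) ∸ n ≡ suc m
1+m+n∸n≡1+m m n = ≡.trans (cong (λ t → suc t ∸ n) (+-comm m n)) (1+m+n∸m≡1+n n m)

module _ {c ℓ} (R : CommutativeRing c ℓ) where
  open CommutativeRing R
    using (Carrier; _≈_; _*_; 0#; refl; sym; trans; reflexive; *-cong; *-congˡ; *-congʳ; zeroˡ; zeroʳ)

  prod-cong : ∀ N {f g : ℕ → Carrier} → (∀ a → a < N → f a ≈ g a) → prod R N f ≈ prod R N g
  prod-cong zero    f≈g = refl
  prod-cong (suc N) f≈g = *-cong (prod-cong N λ a a<N → f≈g a (m<n⇒m<1+n a<N)) (f≈g N ≤-refl)

  prod≈0 : ∀ N {f : ℕ → Carrier} {a} → a < N → f a ≈ 0# → prod R N f ≈ 0#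
  prod≈0 (suc N) {f} {a} a<1+N fa≈0 with m≤n⇒m<n∨m≡n (m<1+n⇒m≤n a<1+N)
  ... | inj₁ a<N    = trans (*-congʳ (prod≈0 N a<N fa≈0)) (zeroˡ (f N))
  ... | inj₂ ≡.refl = trans (*-congˡ fa≈0) (zeroʳ (prod R N f))

  *-annihilatedˡ : ∀ {x y} → x ≈ 0# → x * y ≈ 0#
  *-annihilatedˡ {y = y} x≈0 = trans (*-congʳ x≈0) (zeroˡ y)

  *-annihilatedʳ : ∀ {x y} → y ≈ 0# → x * y ≈ 0#
  *-annihilatedʳ {x} y≈0 = trans (*-congˡ y≈0) (zeroʳ x)

  SDRIdentityAt : Matrix R → ℕ → ℕ → ℕ → ℕ → Set ℓ
  SDRIdentityAt A n k p r =
    prod R (suc r) (λ i → A (n + i) (k + (r ∸ i)))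
      * prod R (p ∸ r) (λ i → A (n + (p ∸ i)) (k + (r + i + 1)))
    ≈ prod R (suc r) (λ i → A (n + (p ∸ i)) (k + (p ∸ r) + i))
      * prod R (p ∸ r) (λ i → A (n + i) (k + ((p ∸ r) ∸ suc i)))

  AgreeBelowDiagonal : Matrix R → Matrix R → Set ℓ
  AgreeBelowDiagonal B C = ∀ x y → y ≤ x → B x y ≈ C x y

  module _ {B C : Matrix R} (B≈C : AgreeBelowDiagonal B C) where

    prod-agree : ∀ N (x y : ℕ → ℕ) → (∀ a → a < N → y a ≤ x a) →
      prod R N (λ a → B (x a) (y a)) ≈ prod R N (λ a → C (x a) (y a))
    prod-agree N x y below = prod-cong N λ a a<N → B≈C (x a) (y a) (below a a<N)

    SDRIdentityAt-agree : ∀ {n k} r s → k + r ≤ n → k + s ≤ n →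
      SDRIdentityAt C n k (suc (r + s)) r → SDRIdentityAt B n k (suc (r + s)) r
    SDRIdentityAt-agree {n} {k} r s k+r≤n k+s≤n identityC =
      trans (*-cong (prod-agree (suc r) _ _ below₁) (prod-agree (p ∸ r) _ _ below₂))
        (trans identityC
          (sym (*-cong (prod-agree (suc r) _ _ below₃) (prod-agree (p ∸ r) _ _ below₄))))
      where
      p : ℕ
      p = suc (r + s)

      p∸r≡1+s : p ∸ r ≡ suc s
      p∸r≡1+s = 1+m+n∸m≡1+n r s

      a<p∸r⇒a≤s : ∀ {a} → a < p ∸ r → a ≤ s
      a<p∸r⇒a≤s {a} a<p∸r = m<1+n⇒m≤n (subst (a <_) p∸r≡1+s a<p∸r)

      rearrange₂ : ∀ k a r → k + a + suc r ≡ k + (r + a + 1)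
      rearrange₂ = solve-∀

      rearrange₃ : ∀ k a s → k + a + suc s ≡ k + suc s + a
      rearrange₃ = solve-∀

      s+[1+r]≡p : s + suc r ≡ p
      s+[1+r]≡p = ≡.trans (+-suc s r) (cong suc (+-comm s r))

      below₁ : ∀ a → a < suc r → k + (r ∸ a) ≤ n + a
      below₁ a _ = k+[x∸a]≤n+a a k+r≤n

      below₂ : ∀ a → a < p ∸ r → k + (r + a + 1) ≤ n + (p ∸ a)
      below₂ a a<p∸r = subst₂ _≤_ (rearrange₂ k a r) (cong (λ t → n + (t ∸ a)) s+[1+r]≡p)
        (k+a+y≤n+[x+y∸a] (suc r) (a<p∸r⇒a≤s a<p∸r) k+s≤n)

      below₃ : ∀ a → a < suc r → k + (p ∸ r) + a ≤ n + (p ∸ a)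
      below₃ a a<1+r =
        subst₂ _≤_ (≡.trans (rearrange₃ k a s) (cong (λ t → k + t + a) (≡.sym p∸r≡1+s)))
          (cong (λ t → n + (t ∸ a)) (+-suc r s))
          (k+a+y≤n+[x+y∸a] (suc s) (m<1+n⇒m≤n a<1+r) k+r≤n)

      below₄ : ∀ a → a < p ∸ r → k + ((p ∸ r) ∸ suc a) ≤ n + a
      below₄ a _ = subst (λ t → k + (t ∸ suc a) ≤ n + a) (≡.sym p∸r≡1+s) (k+[x∸a]≤n+a a k+s≤n)

  module _ {B : Matrix R} (lowerB : LowerTriangular R B) where

    SDRIdentityAt-vanishing₁ : ∀ {n k} p r → n < k + r → SDRIdentityAt B n k p r
    SDRIdentityAt-vanishing₁ {n} {k} p r n<k+r =
      trans (*-annihilatedˡ (prod≈0 (suc r) z<s (lowerB _ _ n+0<k+r)))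
        (sym (*-annihilatedˡ (prod≈0 (suc r) ≤-refl (lowerB _ _ (n+y<k+y+x {k = k} {x = r} (p ∸ r) n<k+r)))))
      where
      n+0<k+r : n + 0 < k + r
      n+0<k+r = subst (_< k + r) (≡.sym (+-identityʳ n)) n<k+r

    SDRIdentityAt-vanishing₂ : ∀ {n k} r s → n < k + s → SDRIdentityAt B n k (suc (r + s)) r
    SDRIdentityAt-vanishing₂ {n} {k} r s n<k+s =
      trans (*-annihilatedʳ (prod≈0 (p ∸ r) s<p∸r (lowerB _ _ last-entry-above)))
        (sym (*-annihilatedʳ (prod≈0 (p ∸ r) 0<p∸r (lowerB _ _ first-entry-above))))
      where
      p : ℕ
      p = suc (r + s)

      p∸r≡1+s : p ∸ r ≡ suc s
      p∸r≡1+s = 1+m+n∸m≡1+n r s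

      s<p∸r : s < p ∸ r
      s<p∸r = subst (s <_) (≡.sym p∸r≡1+s) ≤-refl

      0<p∸r : 0 < p ∸ r
      0<p∸r = subst (0 <_) (≡.sym p∸r≡1+s) z<s

      rearrange : ∀ k r s → k + suc r + s ≡ k + (r + s + 1)
      rearrange = solve-∀

      last-entry-above : n + (p ∸ s) < k + (r + s + 1)
      last-entry-above = subst₂ _<_ (cong (n +_) (≡.sym (1+m+n∸n≡1+m r s))) (rearrange k r s)
        (n+y<k+y+x {k = k} {x = s} (suc r) n<k+s)

      first-entry-above : n + 0 < k + ((p ∸ r) ∸ 1)
      first-entry-above =
        subst₂ _<_ (≡.sym (+-identityʳ n)) (cong (λ t → k + (t ∸ 1)) (≡.sym p∸r≡1+s)) n<k+s

  SDRIdentities-agree : ∀ {m B C} → LowerTriangular R B → AgreeBelowDiagonal B C →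
    SDRIdentities R m C → SDRIdentities R m B
  SDRIdentities-agree lowerB B≈C identitiesC n k (suc p) r 2≤p p≤m r≤p
    with m≤n⇒∃[o]m+o≡n r≤p
  ... | s , ≡.refl with k + r ≤? n | k + s ≤? n
  ... | no k+r≰n | _          = SDRIdentityAt-vanishing₁ lowerB (suc p) r (≰⇒> k+r≰n)
  ... | yes _    | no k+s≰n   = SDRIdentityAt-vanishing₂ lowerB r s (≰⇒> k+s≰n)
  ... | yes k+r≤n | yes k+s≤n =
    SDRIdentityAt-agree B≈C r s k+r≤n k+s≤n (identitiesC n k (suc p) r 2≤p p≤m r≤p)

  translate : ℕ → ℕ → Matrix R → Matrix R
  translate i j A x y = A (i + x) (j + y)

  SDRIdentities-translate : ∀ {m A} i j → SDRIdentities R m A → SDRIdentities R m (translate i j A)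
  SDRIdentities-translate {A = A} i j identitiesA n k p r 2≤p p≤m r≤p =
    trans (*-cong (prod-cong (suc r) λ a _ → entry (≡.sym (+-assoc i n a)) (≡.sym (+-assoc j k (r ∸ a))))
                  (prod-cong (p ∸ r) λ a _ →
                    entry (≡.sym (+-assoc i n (p ∸ a))) (≡.sym (+-assoc j k (r + a + 1)))))
      (trans (identitiesA (i + n) (j + k) p r 2≤p p≤m r≤p)
        (*-cong (prod-cong (suc r) λ a _ → entry (+-assoc i n (p ∸ a)) (j+k+q+a j k a))
                (prod-cong (p ∸ r) λ a _ → entry (+-assoc i n a) (+-assoc j k ((p ∸ r) ∸ suc a)))))
    where
    entry : ∀ {x x′ y y′} → x ≡ x′ → y ≡ y′ → A x y ≈ A x′ y′
    entry x≡x′ y≡y′ = reflexive (cong₂ A x≡x′ y≡y′)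

    j+k+q+a : ∀ j k a → j + k + (p ∸ r) + a ≡ j + (k + (p ∸ r) + a)
    j+k+q+a j k a = ≡.trans (cong (_+ a) (+-assoc j k (p ∸ r))) (+-assoc j (k + (p ∸ r)) a)

  shift-lowerTriangular : ∀ i j A → LowerTriangular R (shift R i j A)
  shift-lowerTriangular i j A n k n<k with k ≤? n
  ... | yes k≤n = contradiction k≤n (<⇒≱ n<k)
  ... | no _    = refl

  shift-agrees-translate : ∀ i j A → AgreeBelowDiagonal (shift R i j A) (translate i j A)
  shift-agrees-translate i j A n k k≤n with k ≤? n
  ... | yes _   = reflexive (cong₂ A (+-comm n i) (+-comm k j))
  ... | no k≰n = contradiction k≤n k≰n

lemma2p2 : ∀ {c ℓ} (R : CommutativeRing c ℓ) (m : ℕ) → 3 ≤ m →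
    (A : Matrix R) → SDR R m A →
    (i j : ℕ) → SDR R m (shift R i j A)
lemma2p2 R m _ A (_ , identitiesA) i j =
  shift-lowerTriangular R i j A ,
  SDRIdentities-agree R {m} (shift-lowerTriangular R i j A) (shift-agrees-translate R i j A)
    (SDRIdentities-translate R {m} {A} i j identitiesA)
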